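{- For all integers $r\geq 2$ and $k_1\geq k_2\geq\cdots\geq k_r\geq 2$, \[ M_r(k_1,\dots,k_r)\leq \frac{(k_1+k_2-2)(k_1+k_2-3)}{(k_1-1)(k_2-1)}\binom{k_1+\cdots+k_r-2r}{k_1-2,\dots,k_r-2}. \] In particular, for all integers $r,k\geq 2$, \[ M_r(k)\leq \left(4-\frac{2}{k-1}\right)\frac{(r(k-2))!}{((k-2)!)^r}. \]
   Context: For each integer $r\geq 2$, $M_r:\mathbb{Z}_{\geq 2}^r\to\mathbb{Z}_{\geq 0}$ denotes the family of functions uniquely determined by: (i) $M_2(k_1,k_2)=\binom{k_1+k_2-2}{k_1-1}$ for $k_1,k_2\geq 2$; (ii) for $r\geq 2$ and $k_1,\dots,k_r\geq 2$, inserting a coordinate equal to $2$ at any position of $(k_1,\dots,k_r)$ gives an $(r+1)$-tuple at which $M_{r+1}$ equals $M_r(k_1,\dots,k_r)$; (iii) for $k_1,\dots,k_r\geq 3$, $M_r(k_1,\dots,k_r)=\sum_{i=1}^r M_r(k_1,\dots,k_i-1,\dots,k_r)$ (the $i$-th coordinate decreased by $1$). $M_r(k)$ means $M_r(k,\dots,k)$. The multinomial coefficient $\binom{n}{a_1,\dots,a_r}$ with $a_1+\cdots+a_r=n$, $a_i\geq 0$, equals $\frac{n!}{a_1!\cdots a_r!}$. -}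

module Defs where

open import Data.Nat using (ℕ; zero; suc; _+_; _*_; _∸_; _^_; _≤_; NonZero; pred)
open import Data.Nat.Properties using (_!≢0; m*n≢0; m^n≢0)
open import Data.Nat.DivMod using (_/_)
open import Data.Nat.Combinatorics using (_C_)
open import Data.Nat.Base using (_!)
open import Data.Fin using (Fin)
open import Data.Vec using (Vec; []; _∷_; insertAt; updateAt; tabulate; sum; replicate)
open import Data.Vec.Relation.Unary.All using (All)
open import Relation.Binary.PropositionalEquality using (_≡_)

prodFact : ∀ {r} → Vec ℕ r → ℕ
prodFact []       = 1
prodFact (a ∷ as) = a ! * prodFact as

prodFact≢0 : ∀ {r} (v : Vec ℕ r) → NonZero (prodFact v)
prodFact≢0 []       = _
prodFact≢0 (a ∷ as) = m*n≢0 (a !) (prodFact as) {{a !≢0}} {{prodFact≢0 as}}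

multinomial : ∀ {r} → Vec ℕ r → ℕ
multinomial v = _/_ (sum v !) (prodFact v) {{prodFact≢0 v}}

-- The characterizing properties (i)-(iii) of the family (M_r)_{r ≥ 2}.
-- M r v is only constrained for r ≥ 2 and entries of v all ≥ 2.
record IsMFamily (M : (r : ℕ) → Vec ℕ r → ℕ) : Set where
  field
    base : ∀ k₁ k₂ → 2 ≤ k₁ → 2 ≤ k₂ →
           M 2 (k₁ ∷ k₂ ∷ []) ≡ (k₁ + k₂ ∸ 2) C (k₁ ∸ 1)
    insert2 : ∀ r → 2 ≤ r → (v : Vec ℕ r) → All (2 ≤_) v →
              (i : Fin (suc r)) → M (suc r) (insertAt v i 2) ≡ M r v
    recur : ∀ r → 2 ≤ r → (v : Vec ℕ r) → All (3 ≤_) v →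
            M r v ≡ sum (tabulate (λ i → M r (updateAt v i pred)))

{-# OPTIONS --safe #-}
-- Write num A B = (A + B − 2)(A + B − 3), den A B = (A − 1)(B − 1), and μ v for the multinomial
-- coefficient of the entries of v lowered by 2.  For every v with entries ≥ 2 and positions t ≠ s
-- carrying its two largest entries A, B, we show  M v · den A B ≤ num A B · μ v  by induction on the
-- sum of v.  For two entries this is an identity of binomial coefficients, and an entry 2 outside
-- t, s can be deleted by (ii) without changing μ.  Otherwise all entries are ≥ 3 and (iii) applies.
-- With N = Σ (vᵢ − 2), lowering vᵢ multiplies μ by (vᵢ − 2) / N, so the induction hypothesis
-- handles every i ∉ {t, s}.  Lowering A costs at most share A B · μ / N, where
-- share A B = (A − 1)(A + B − 3)(A + B − 4), both when A stays the largest entry and when it ties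
-- with a third one (which then forces A ≤ B); since share A B + share B A = num A B · (A − 2 + B − 2),
-- all terms add up to num A B · μ v.  The diagonal bound is the case k₁ = ⋯ = k_r.
module Submission where

open import Defs
open import Data.Nat using (ℕ; zero; suc; pred; _+_; _*_; _∸_; _^_; _≤_; _<_; _!; s≤s; z≤n; >-nonZero)
open import Data.Nat.Properties
open import Data.Nat.Divisibility using (_∣_; ∣-refl; ∣-trans; *-monoʳ-∣)
open import Data.Nat.DivMod using (_/_; m/n*n≡m; /-congˡ; /-congʳ)
open import Data.Nat.Combinatorics using (_C_; nCk≡n!/k![n-k]!; k![n∸k]!∣n!)
open import Data.Nat.Tactic.RingSolver using (solve-∀)
open import Data.Fin using (Fin; zero; suc; punchIn; punchOut) renaming (_≟_ to _≟ᶠ_)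
open import Data.Fin.Properties using (any?; punchIn-punchOut; punchIn-injective; punchInᵢ≢i)
open import Data.Vec using (Vec; []; _∷_; lookup; sum; map; replicate; tabulate; insertAt; removeAt; updateAt)
open import Data.Vec.Properties
  using (lookup∘updateAt; lookup∘updateAt′; lookup-map; map-updateAt; map-insertAt; insertAt-punchIn;
         insertAt-removeAt; tabulate∘lookup; tabulate-∘; lookup-replicate; map-replicate)
open import Data.Vec.Relation.Unary.All using (All)
open import Data.Vec.Relation.Unary.All.Properties using (lookup⁺; lookup⁻)
open import Data.Product using (_×_; _,_)
open import Function using (_∘_)
open import Relation.Binary.PropositionalEquality
open import Relation.Nullary using (yes; no; ¬?)
open import Relation.Nullary.Decidable using (_×-dec_)
open import Relation.Nullary.Negation using (contradiction)
open import Algebra.Properties.CommutativeSemigroup +-commutativeSemigroup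
  using () renaming (x∙yz≈y∙xz to x+[y+z]≡y+[x+z])
open import Algebra.Properties.CommutativeSemigroup *-commutativeSemigroup
  using () renaming (x∙yz≈y∙xz to x*[y*z]≡y*[x*z])

nCk*[k!*[n∸k]!]≡n! : ∀ {n k} → k ≤ n → (n C k) * (k ! * (n ∸ k) !) ≡ n !
nCk*[k!*[n∸k]!]≡n! {n} {k} k≤n =
  trans (cong (_* (k ! * (n ∸ k) !)) (nCk≡n!/k![n-k]! k≤n))
        (m/n*n≡m {{m*n≢0 (k !) ((n ∸ k) !) {{k !≢0}} {{(n ∸ k) !≢0}}}} (k![n∸k]!∣n! k≤n))

[a+b]Ca*[a!*b!]≡[a+b]! : ∀ a b → ((a + b) C a) * (a ! * b !) ≡ (a + b) !
[a+b]Ca*[a!*b!]≡[a+b]! a b =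
  subst (λ c → ((a + b) C a) * (a ! * c !) ≡ (a + b) !) (m+n∸m≡n a b) (nCk*[k!*[n∸k]!]≡n! (m≤m+n a b))

a!*b!∣[a+b]! : ∀ a b → a ! * b ! ∣ (a + b) !
a!*b!∣[a+b]! a b = subst (λ c → a ! * c ! ∣ (a + b) !) (m+n∸m≡n a b) (k![n∸k]!∣n! (m≤m+n a b))

prodFact∣sum! : ∀ {r} (v : Vec ℕ r) → prodFact v ∣ sum v !
prodFact∣sum! []       = ∣-refl
prodFact∣sum! (a ∷ as) = ∣-trans (*-monoʳ-∣ (a !) (prodFact∣sum! as)) (a!*b!∣[a+b]! a (sum as))

multinomial*prodFact≡sum! : ∀ {r} (v : Vec ℕ r) → multinomial v * prodFact v ≡ sum v !
multinomial*prodFact≡sum! v = m/n*n≡m {{prodFact≢0 v}} (prodFact∣sum! v)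

multinomial-cong : ∀ {r s} (v : Vec ℕ r) (w : Vec ℕ s) →
                   sum v ≡ sum w → prodFact v ≡ prodFact w → multinomial v ≡ multinomial w
multinomial-cong v w Σ≡ Π≡ =
  trans (/-congˡ {{prodFact≢0 v}} (cong _! Σ≡)) (/-congʳ {{prodFact≢0 v}} {{prodFact≢0 w}} Π≡)

sum-insertAt : ∀ {r} (v : Vec ℕ r) i x → sum (insertAt v i x) ≡ x + sum v
sum-insertAt v       zero    x = refl
sum-insertAt (y ∷ v) (suc i) x = trans (cong (y +_) (sum-insertAt v i x)) (x+[y+z]≡y+[x+z] y x (sum v))

prodFact-insertAt-0 : ∀ {r} (v : Vec ℕ r) i → prodFact (insertAt v i 0) ≡ prodFact v
prodFact-insertAt-0 v       zero    = +-identityʳ (prodFact v)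
prodFact-insertAt-0 (x ∷ v) (suc i) = cong (x ! *_) (prodFact-insertAt-0 v i)

multinomial-insertAt-0 : ∀ {r} (v : Vec ℕ r) i → multinomial (insertAt v i 0) ≡ multinomial v
multinomial-insertAt-0 v i = multinomial-cong (insertAt v i 0) v (sum-insertAt v i 0) (prodFact-insertAt-0 v i)

sum-updateAt-pred : ∀ {r} (v : Vec ℕ r) i → 1 ≤ lookup v i → suc (sum (updateAt v i pred)) ≡ sum v
sum-updateAt-pred (suc x ∷ v) zero    _   = refl
sum-updateAt-pred (x ∷ v)     (suc i) vᵢ≥1 = trans (sym (+-suc x _)) (cong (x +_) (sum-updateAt-pred v i vᵢ≥1))

prodFact-updateAt-pred : ∀ {r} (v : Vec ℕ r) i → 1 ≤ lookup v i →
                         lookup v i * prodFact (updateAt v i pred) ≡ prodFact v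
prodFact-updateAt-pred (suc x ∷ v) zero    _    = sym (*-assoc (suc x) (x !) (prodFact v))
prodFact-updateAt-pred (x ∷ v)     (suc i) vᵢ≥1 =
  trans (x*[y*z]≡y*[x*z] (lookup v i) (x !) _) (cong (x ! *_) (prodFact-updateAt-pred v i vᵢ≥1))

multinomial-updateAt-pred : ∀ {r} (v : Vec ℕ r) i → 1 ≤ lookup v i →
                            multinomial (updateAt v i pred) * sum v ≡ lookup v i * multinomial v
multinomial-updateAt-pred v i vᵢ≥1 = *-cancelʳ-≡ _ _ (prodFact w) {{prodFact≢0 w}} (begin
  multinomial w * sum v * prodFact w        ≡⟨ *-assoc (multinomial w) (sum v) (prodFact w) ⟩
  multinomial w * (sum v * prodFact w)      ≡⟨ x*[y*z]≡y*[x*z] (multinomial w) (sum v) (prodFact w) ⟩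
  sum v * (multinomial w * prodFact w)      ≡⟨ cong (sum v *_) (multinomial*prodFact≡sum! w) ⟩
  sum v * sum w !                           ≡⟨ cong (λ n → n * sum w !) Σ≡ ⟨
  suc (sum w) !                             ≡⟨ cong _! Σ≡ ⟩
  sum v !                                   ≡⟨ multinomial*prodFact≡sum! v ⟨
  multinomial v * prodFact v                ≡⟨ cong (multinomial v *_) (prodFact-updateAt-pred v i vᵢ≥1) ⟨
  multinomial v * (lookup v i * prodFact w) ≡⟨ x*[y*z]≡y*[x*z] (multinomial v) (lookup v i) (prodFact w) ⟩
  lookup v i * (multinomial v * prodFact w) ≡⟨ *-assoc (lookup v i) (multinomial v) (prodFact w) ⟨
  lookup v i * multinomial v * prodFact w   ∎)
  where
  open ≡-Reasoning
  w  = updateAt v i pred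
  Σ≡ = sum-updateAt-pred v i vᵢ≥1

reduced : ∀ {r} → Vec ℕ r → Vec ℕ r
reduced = map (_∸ 2)

multinomial-reduced-updateAt-pred : ∀ {r} (v : Vec ℕ r) i → 3 ≤ lookup v i →
  multinomial (reduced (updateAt v i pred)) * sum (reduced v) ≡ (lookup v i ∸ 2) * multinomial (reduced v)
multinomial-reduced-updateAt-pred v i vᵢ≥3 = begin
  multinomial (reduced (updateAt v i pred)) * sum (reduced v)
    ≡⟨ cong (λ u → multinomial u * sum (reduced v)) (map-updateAt v i pred∸2≡pred[∸2]) ⟩
  multinomial (updateAt (reduced v) i pred) * sum (reduced v)
    ≡⟨ multinomial-updateAt-pred (reduced v) i (subst (1 ≤_) (sym lookup-reduced) (∸-monoˡ-≤ 2 vᵢ≥3)) ⟩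
  lookup (reduced v) i * multinomial (reduced v)
    ≡⟨ cong (_* multinomial (reduced v)) lookup-reduced ⟩
  (lookup v i ∸ 2) * multinomial (reduced v) ∎
  where
  open ≡-Reasoning
  x = lookup v i
  pred∸2≡pred[∸2] : pred x ∸ 2 ≡ pred (x ∸ 2)
  pred∸2≡pred[∸2] = trans (∸-+-assoc x 1 2) (sym (pred[m∸n]≡m∸[1+n] x 2))
  lookup-reduced : lookup (reduced v) i ≡ x ∸ 2
  lookup-reduced = lookup-map i (_∸ 2) v

sum-replicate : ∀ r a → sum (replicate r a) ≡ r * a
sum-replicate zero    a = refl
sum-replicate (suc r) a = cong (a +_) (sum-replicate r a)

prodFact-replicate : ∀ r a → prodFact (replicate r a) ≡ (a !) ^ r
prodFact-replicate zero    a = refl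
prodFact-replicate (suc r) a = cong (a ! *_) (prodFact-replicate r a)

multinomial-replicate : ∀ r a →
  multinomial (replicate r a) ≡ _/_ ((r * a) !) ((a !) ^ r) {{m^n≢0 (a !) r {{a !≢0}}}}
multinomial-replicate r a =
  trans (/-congˡ {{prodFact≢0 (replicate r a)}} (cong _! (sum-replicate r a)))
        (/-congʳ {{prodFact≢0 (replicate r a)}} {{m^n≢0 (a !) r {{a !≢0}}}} (prodFact-replicate r a))

binomial-base : ∀ p q →
  ((2 + (p + q)) C (1 + p)) * ((1 + p) * (1 + q)) ≡ (2 + (p + q)) * (1 + (p + q)) * multinomial (p ∷ q ∷ [])
binomial-base p q = *-cancelʳ-≡ _ _ F {{prodFact≢0 (p ∷ q ∷ [])}} (begin
  ((2 + n) C (1 + p)) * ((1 + p) * (1 + q)) * F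
    ≡⟨ regroup ((2 + n) C (1 + p)) p q (p !) (q !) ⟩
  ((2 + n) C (1 + p)) * ((1 + p) ! * (1 + q) !)
    ≡⟨ subst (λ k → (k C (1 + p)) * ((1 + p) ! * (1 + q) !) ≡ k !) (cong suc (+-suc p q))
             ([a+b]Ca*[a!*b!]≡[a+b]! (1 + p) (1 + q)) ⟩
  (2 + n) !
    ≡⟨ *-assoc (2 + n) (1 + n) (n !) ⟨
  (2 + n) * (1 + n) * n !
    ≡⟨ cong (λ k → (2 + n) * (1 + n) * (p + k) !) (+-identityʳ q) ⟨
  (2 + n) * (1 + n) * sum (p ∷ q ∷ []) !
    ≡⟨ cong ((2 + n) * (1 + n) *_) (multinomial*prodFact≡sum! (p ∷ q ∷ [])) ⟨
  (2 + n) * (1 + n) * (multinomial (p ∷ q ∷ []) * F)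
    ≡⟨ *-assoc ((2 + n) * (1 + n)) (multinomial (p ∷ q ∷ [])) F ⟨
  (2 + n) * (1 + n) * multinomial (p ∷ q ∷ []) * F ∎)
  where
  open ≡-Reasoning
  n = p + q
  F = prodFact (p ∷ q ∷ [])
  regroup : ∀ c p q x y → c * ((1 + p) * (1 + q)) * (x * (y * 1)) ≡ c * ((1 + p) * x * ((1 + q) * y))
  regroup = solve-∀

sum-tabulate-mono-≤ : ∀ {n} {f g : Fin n → ℕ} → (∀ i → f i ≤ g i) → sum (tabulate f) ≤ sum (tabulate g)
sum-tabulate-mono-≤ {zero}  f≤g = z≤n
sum-tabulate-mono-≤ {suc n} f≤g = +-mono-≤ (f≤g zero) (sum-tabulate-mono-≤ (f≤g ∘ suc))

sum-tabulate-*ʳ : ∀ {n} (f : Fin n → ℕ) k → sum (tabulate (λ i → f i * k)) ≡ sum (tabulate f) * k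
sum-tabulate-*ʳ {zero}  f k = refl
sum-tabulate-*ʳ {suc n} f k =
  trans (cong (f zero * k +_) (sum-tabulate-*ʳ (f ∘ suc) k)) (sym (*-distribʳ-+ k (f zero) _))

sum-tabulate-punchIn : ∀ {n} (f : Fin (suc n) → ℕ) i → sum (tabulate f) ≡ f i + sum (tabulate (f ∘ punchIn i))
sum-tabulate-punchIn         f zero    = refl
sum-tabulate-punchIn {suc n} f (suc i) =
  trans (cong (f zero +_) (sum-tabulate-punchIn (f ∘ suc) i))
        (x+[y+z]≡y+[x+z] (f zero) (f (suc i)) (sum (tabulate (f ∘ suc ∘ punchIn i))))

lookup≤sum : ∀ {r} (v : Vec ℕ r) i → lookup v i ≤ sum v
lookup≤sum (x ∷ v) zero    = m≤m+n x (sum v)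
lookup≤sum (x ∷ v) (suc i) = ≤-trans (lookup≤sum v i) (m≤n+m (sum v) x)

sum-map-lookup : ∀ {r} (g : ℕ → ℕ) (v : Vec ℕ r) → sum (map g v) ≡ sum (tabulate (g ∘ lookup v))
sum-map-lookup g v =
  cong sum (trans (cong (map g) (sym (tabulate∘lookup v))) (sym (tabulate-∘ g (lookup v))))

module _ {n} {t s : Fin (suc (suc n))} (t≢s : t ≢ s) where

  punchIn₂ : Fin n → Fin (suc (suc n))
  punchIn₂ j = punchIn t (punchIn (punchOut t≢s) j)

  punchIn₂≢first : ∀ j → punchIn₂ j ≢ t
  punchIn₂≢first j = punchInᵢ≢i t (punchIn (punchOut t≢s) j)

  punchIn₂≢second : ∀ j → punchIn₂ j ≢ s
  punchIn₂≢second j eq =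
    punchInᵢ≢i (punchOut t≢s) j (punchIn-injective t _ _ (trans eq (sym (punchIn-punchOut t≢s))))

sum-tabulate-mono-≤-except₂ : ∀ {n} {f g : Fin n → ℕ} {t s} → t ≢ s →
  (∀ i → i ≢ t → i ≢ s → f i ≤ g i) → f t + f s ≤ g t + g s → sum (tabulate f) ≤ sum (tabulate g)
sum-tabulate-mono-≤-except₂ {suc zero}    {t = zero} {zero} t≢s _ _ = contradiction refl t≢s
sum-tabulate-mono-≤-except₂ {suc (suc n)} {f} {g} {t} {s} t≢s f≤g pair = begin
  sum (tabulate f)   ≡⟨ split f ⟩
  f t + f s + rest f ≤⟨ +-mono-≤ pair (sum-tabulate-mono-≤ (λ j → f≤g _ (punchIn₂≢first t≢s j)
                                                                       (punchIn₂≢second t≢s j))) ⟩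
  g t + g s + rest g ≡⟨ split g ⟨
  sum (tabulate g)   ∎
  where
  open ≤-Reasoning
  rest : (Fin (suc (suc n)) → ℕ) → ℕ
  rest h = sum (tabulate (h ∘ punchIn₂ t≢s))
  split : ∀ h → sum (tabulate h) ≡ h t + h s + rest h
  split h = begin-equality
    sum (tabulate h)                                ≡⟨ sum-tabulate-punchIn h t ⟩
    h t + sum (tabulate (h ∘ punchIn t))
      ≡⟨ cong (h t +_) (sum-tabulate-punchIn (h ∘ punchIn t) (punchOut t≢s)) ⟩
    h t + (h (punchIn t (punchOut t≢s)) + rest h)   ≡⟨ cong (λ k → h t + (h k + rest h)) (punchIn-punchOut t≢s) ⟩
    h t + (h s + rest h)                            ≡⟨ +-assoc (h t) (h s) (rest h) ⟨
    h t + h s + rest h                              ∎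

num : ℕ → ℕ → ℕ
num A B = (A + B ∸ 2) * (A + B ∸ 3)

den : ℕ → ℕ → ℕ
den A B = (A ∸ 1) * (B ∸ 1)

share : ℕ → ℕ → ℕ
share A B = (A ∸ 1) * num (pred A) B

num-comm : ∀ A B → num A B ≡ num B A
num-comm A B = cong (λ n → (n ∸ 2) * (n ∸ 3)) (+-comm A B)

den-comm : ∀ A B → den A B ≡ den B A
den-comm A B = *-comm (A ∸ 1) (B ∸ 1)

[1+a]+[2+b]≡3+[a+b] : ∀ a b → (1 + a) + (2 + b) ≡ 3 + (a + b)
[1+a]+[2+b]≡3+[a+b] a b = cong suc (trans (+-suc a (suc b)) (cong suc (+-suc a b)))

num-1+2+ : ∀ a b → num (1 + a) (2 + b) ≡ (1 + (a + b)) * (a + b)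
num-1+2+ a b = cong (λ n → (n ∸ 2) * (n ∸ 3)) ([1+a]+[2+b]≡3+[a+b] a b)

share+share≡num*[A∸2+B∸2] : ∀ {A B} → 3 ≤ A → 3 ≤ B →
                            share A B + share B A ≡ num A B * ((A ∸ 2) + (B ∸ 2))
share+share≡num*[A∸2+B∸2] {suc (suc (suc a))} {suc (suc (suc b))} (s≤s (s≤s (s≤s _))) (s≤s (s≤s (s≤s _))) =
  begin
    (2 + a) * num (2 + a) (3 + b) + (2 + b) * num (2 + b) (3 + a)
      ≡⟨ cong₂ (λ x y → (2 + a) * x + (2 + b) * y) (num-1+2+ (1 + a) (1 + b)) (num-1+2+ (1 + b) (1 + a)) ⟩
    (2 + a) * ((2 + (a + (1 + b))) * (1 + (a + (1 + b)))) + (2 + b) * ((2 + (b + (1 + a))) * (1 + (b + (1 + a))))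
      ≡⟨ identity a b ⟩
    (3 + (a + (1 + b))) * (2 + (a + (1 + b))) * ((1 + a) + (1 + b))
      ≡⟨ cong (_* ((1 + a) + (1 + b))) (num-1+2+ (2 + a) (1 + b)) ⟨
    num (3 + a) (3 + b) * ((1 + a) + (1 + b)) ∎
  where
  open ≡-Reasoning
  identity : ∀ a b →
    (2 + a) * ((2 + (a + (1 + b))) * (1 + (a + (1 + b)))) + (2 + b) * ((2 + (b + (1 + a))) * (1 + (b + (1 + a))))
      ≡ (3 + (a + (1 + b))) * (2 + (a + (1 + b))) * ((1 + a) + (1 + b))
  identity = solve-∀

num*[A∸2]≤share : ∀ {A B} → 2 ≤ A → A ≤ B → num A B * (A ∸ 2) ≤ share A B
num*[A∸2]≤share {suc (suc a)} {B} (s≤s (s≤s _)) A≤B with d , refl ← m≤n⇒∃[o]m+o≡n A≤B = begin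
  num (2 + a) (2 + (a + d)) * a                  ≡⟨ cong (_* a) (num-1+2+ (1 + a) (a + d)) ⟩
  (2 + (a + (a + d))) * (1 + (a + (a + d))) * a  ≡⟨ rearrange a d ⟩
  (1 + (a + (a + d))) * ((2 + (a + (a + d))) * a) ≤⟨ *-monoʳ-≤ (1 + (a + (a + d))) (m≤m+n _ d) ⟩
  (1 + (a + (a + d))) * ((2 + (a + (a + d))) * a + d) ≡⟨ expand a d ⟩
  (1 + a) * ((1 + (a + (a + d))) * (a + (a + d)))   ≡⟨ cong ((1 + a) *_) (num-1+2+ a (a + d)) ⟨
  share (2 + a) (2 + (a + d))                     ∎
  where
  open ≤-Reasoning
  rearrange : ∀ a d → (2 + (a + (a + d))) * (1 + (a + (a + d))) * a ≡ (1 + (a + (a + d))) * ((2 + (a + (a + d))) * a)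
  rearrange = solve-∀
  expand : ∀ a d → (1 + (a + (a + d))) * ((2 + (a + (a + d))) * a + d) ≡ (1 + a) * ((1 + (a + (a + d))) * (a + (a + d)))
  expand = solve-∀

share-bound-lowered : ∀ {A B m μ′ μ N} → 3 ≤ A →
  m * den (pred A) B ≤ num (pred A) B * μ′ → μ′ * N ≡ (A ∸ 2) * μ → m * (den A B * N) ≤ share A B * μ
share-bound-lowered {suc (suc (suc a))} {B} {m} {μ′} {μ} {N} (s≤s (s≤s (s≤s _))) bound μ′N≡ = begin
  m * ((2 + a) * c * N)   ≡⟨ pull a c m N ⟩
  (2 + a) * (m * (c * N)) ≤⟨ *-monoʳ-≤ (2 + a) cancelled ⟩
  (2 + a) * (q * μ)       ≡⟨ *-assoc (2 + a) q μ ⟨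
  share (3 + a) B * μ     ∎
  where
  open ≤-Reasoning
  c = B ∸ 1
  q = num (2 + a) B
  pull : ∀ a c m N → m * ((2 + a) * c * N) ≡ (2 + a) * (m * (c * N))
  pull = solve-∀
  push : ∀ a c m N → (1 + a) * (m * (c * N)) ≡ m * ((1 + a) * c) * N
  push = solve-∀
  cancelled : m * (c * N) ≤ q * μ
  cancelled = *-cancelˡ-≤ (1 + a) (begin
    (1 + a) * (m * (c * N)) ≡⟨ push a c m N ⟩
    m * ((1 + a) * c) * N   ≤⟨ *-monoˡ-≤ N bound ⟩
    q * μ′ * N              ≡⟨ *-assoc q μ′ N ⟩
    q * (μ′ * N)            ≡⟨ cong (q *_) μ′N≡ ⟩
    q * ((1 + a) * μ)       ≡⟨ x*[y*z]≡y*[x*z] q (1 + a) μ ⟩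
    (1 + a) * (q * μ)       ∎)

share-bound-tied : ∀ {A B m μ′ μ N} → 2 ≤ A → A ≤ B →
  m * den A B ≤ num A B * μ′ → μ′ * N ≡ (A ∸ 2) * μ → m * (den A B * N) ≤ share A B * μ
share-bound-tied {A} {B} {m} {μ′} {μ} {N} A≥2 A≤B bound μ′N≡ = begin
  m * (den A B * N)         ≡⟨ *-assoc m (den A B) N ⟨
  m * den A B * N           ≤⟨ *-monoˡ-≤ N bound ⟩
  num A B * μ′ * N          ≡⟨ *-assoc (num A B) μ′ N ⟩
  num A B * (μ′ * N)        ≡⟨ cong (num A B *_) μ′N≡ ⟩
  num A B * ((A ∸ 2) * μ)   ≡⟨ *-assoc (num A B) (A ∸ 2) μ ⟨
  num A B * (A ∸ 2) * μ     ≤⟨ *-monoˡ-≤ μ (num*[A∸2]≤share A≥2 A≤B) ⟩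
  share A B * μ             ∎
  where open ≤-Reasoning

record TopTwo {r} (v : Vec ℕ r) (t s : Fin r) : Set where
  field
    distinct : t ≢ s
    ≤-first  : ∀ j → j ≢ t → j ≢ s → lookup v j ≤ lookup v t
    ≤-second : ∀ j → j ≢ t → j ≢ s → lookup v j ≤ lookup v s
open TopTwo

TopTwo-sym : ∀ {r} {v : Vec ℕ r} {t s} → TopTwo v t s → TopTwo v s t
TopTwo-sym top = record
  { distinct = distinct top ∘ sym
  ; ≤-first  = λ j j≢s j≢t → ≤-second top j j≢t j≢s
  ; ≤-second = λ j j≢s j≢t → ≤-first top j j≢t j≢s
  }

TopTwo-pullback : ∀ {m n} {v : Vec ℕ m} {w : Vec ℕ n} {ι : Fin n → Fin m} {t s} →
  (∀ {j k} → ι j ≡ ι k → j ≡ k) → (∀ j → lookup w j ≡ lookup v (ι j)) →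
  TopTwo v (ι t) (ι s) → TopTwo w t s
TopTwo-pullback {ι = ι} {t} {s} ι-injective w≡v∘ι top = record
  { distinct = distinct top ∘ cong ι
  ; ≤-first  = λ j j≢t j≢s → subst₂ _≤_ (sym (w≡v∘ι j)) (sym (w≡v∘ι t))
                                (≤-first top (ι j) (j≢t ∘ ι-injective) (j≢s ∘ ι-injective))
  ; ≤-second = λ j j≢t j≢s → subst₂ _≤_ (sym (w≡v∘ι j)) (sym (w≡v∘ι s))
                                (≤-second top (ι j) (j≢t ∘ ι-injective) (j≢s ∘ ι-injective))
  }

TopTwo-all≥ : ∀ {n k} {v : Vec ℕ (3 + n)} {t s} → TopTwo v t s →
                     (∀ j → j ≢ t → j ≢ s → k ≤ lookup v j) → ∀ j → k ≤ lookup v j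
TopTwo-all≥ {k = k} {v} {t} {s} top k≤others = bound
  where
  third    = punchIn₂ (distinct top) zero
  third≢t  = punchIn₂≢first (distinct top) zero
  third≢s  = punchIn₂≢second (distinct top) zero
  bound : ∀ j → k ≤ lookup v j
  bound j with j ≟ᶠ t | j ≟ᶠ s
  ... | yes refl | _        = ≤-trans (k≤others third third≢t third≢s) (≤-first top third third≢t third≢s)
  ... | no _     | yes refl = ≤-trans (k≤others third third≢t third≢s) (≤-second top third third≢t third≢s)
  ... | no j≢t   | no j≢s   = k≤others j j≢t j≢s

module _ {r} (v : Vec ℕ r) where

  lookup-updateAt-pred-≤ : ∀ i j → lookup (updateAt v i pred) j ≤ lookup v j
  lookup-updateAt-pred-≤ i j with j ≟ᶠ i
  ... | yes refl = subst (_≤ lookup v j) (sym (lookup∘updateAt j v)) pred[n]≤n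
  ... | no j≢i   = ≤-reflexive (lookup∘updateAt′ j i j≢i v)

  TopTwo-lower-other : ∀ {i t s} → i ≢ t → i ≢ s → TopTwo v t s → TopTwo (updateAt v i pred) t s
  TopTwo-lower-other {i} {t} {s} i≢t i≢s top = record
    { distinct = distinct top
    ; ≤-first  = λ j j≢t j≢s → ≤-trans (lookup-updateAt-pred-≤ i j)
                   (subst (lookup v j ≤_) (sym (lookup∘updateAt′ t i (i≢t ∘ sym) v)) (≤-first top j j≢t j≢s))
    ; ≤-second = λ j j≢t j≢s → ≤-trans (lookup-updateAt-pred-≤ i j)
                   (subst (lookup v j ≤_) (sym (lookup∘updateAt′ s i (i≢s ∘ sym) v)) (≤-second top j j≢t j≢s))
    }

  TopTwo-lower-first : ∀ {t s} → (∀ j → j ≢ t → j ≢ s → lookup v j < lookup v t) →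
                       TopTwo v t s → TopTwo (updateAt v t pred) t s
  TopTwo-lower-first {t} {s} others<t top = record
    { distinct = distinct top
    ; ≤-first  = λ j j≢t j≢s → subst₂ _≤_ (sym (lookup∘updateAt′ j t j≢t v)) (sym (lookup∘updateAt t v))
                                  (<⇒≤pred (others<t j j≢t j≢s))
    ; ≤-second = λ j j≢t j≢s → subst₂ _≤_ (sym (lookup∘updateAt′ j t j≢t v))
                                  (sym (lookup∘updateAt′ s t (distinct top ∘ sym) v)) (≤-second top j j≢t j≢s)
    }

  TopTwo-lower-first-tied : ∀ {t s j} → j ≢ t → j ≢ s → lookup v j ≡ lookup v t →
                            TopTwo v t s → TopTwo (updateAt v t pred) j s
  TopTwo-lower-first-tied {t} {s} {j} j≢t j≢s vⱼ≡vₜ top = record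
    { distinct = j≢s
    ; ≤-first  = λ l _ l≢s → ≤-trans (lookup-updateAt-pred-≤ t l)
                   (subst (lookup v l ≤_) (trans (sym vⱼ≡vₜ) (sym (lookup∘updateAt′ j t j≢t v))) (≤-t l l≢s))
    ; ≤-second = λ l _ l≢s → ≤-trans (lookup-updateAt-pred-≤ t l)
                   (subst (lookup v l ≤_) (sym (lookup∘updateAt′ s t (distinct top ∘ sym) v)) (≤-s l l≢s))
    }
    where
    ≤-t : ∀ l → l ≢ s → lookup v l ≤ lookup v t
    ≤-t l l≢s with l ≟ᶠ t
    ... | yes refl = ≤-refl
    ... | no l≢t   = ≤-first top l l≢t l≢s
    ≤-s : ∀ l → l ≢ s → lookup v l ≤ lookup v s
    ≤-s l l≢s = ≤-trans (≤-t l l≢s) (subst (_≤ lookup v s) vⱼ≡vₜ (≤-second top j j≢t j≢s))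

sorted⇒TopTwo : ∀ {n} (v : Vec ℕ (2 + n)) → (∀ i j → i Data.Fin.≤ j → lookup v j ≤ lookup v i) →
                TopTwo v zero (suc zero)
sorted⇒TopTwo v sorted = record
  { distinct = λ ()
  ; ≤-first  = λ { zero j≢t _ → contradiction refl j≢t
                 ; (suc zero) _ j≢s → contradiction refl j≢s
                 ; (suc (suc j)) _ _ → sorted zero (suc (suc j)) z≤n }
  ; ≤-second = λ { zero j≢t _ → contradiction refl j≢t
                 ; (suc zero) _ j≢s → contradiction refl j≢s
                 ; (suc (suc j)) _ _ → sorted (suc zero) (suc (suc j)) (s≤s z≤n) }
  }

num-diagonal : ∀ a → num (2 + a) (2 + a) ≡ (1 + a) * (4 * (1 + a) ∸ 2)
num-diagonal a = begin
  num (2 + a) (2 + a)              ≡⟨ num-1+2+ (1 + a) a ⟩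
  (2 + (a + a)) * (1 + (a + a))    ≡⟨ factor a ⟩
  (1 + a) * (2 + (2 + 4 * a) ∸ 2)  ≡⟨ cong (λ x → (1 + a) * (x ∸ 2)) (expand a) ⟨
  (1 + a) * (4 * (1 + a) ∸ 2)      ∎
  where
  open ≡-Reasoning
  factor : ∀ a → (2 + (a + a)) * (1 + (a + a)) ≡ (1 + a) * (2 + 4 * a)
  factor = solve-∀
  expand : ∀ a → 4 * (1 + a) ≡ 2 + (2 + 4 * a)
  expand = solve-∀

module Bounds (M : (r : ℕ) → Vec ℕ r → ℕ) (isM : IsMFamily M) where
  open IsMFamily isM

  BoundedAt : ∀ {r} → Vec ℕ r → ℕ → ℕ → Set
  BoundedAt {r} v A B = M r v * den A B ≤ num A B * multinomial (reduced v)

  Bounded : ∀ {r} → Vec ℕ r → Fin r → Fin r → Set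
  Bounded v t s = BoundedAt v (lookup v t) (lookup v s)

  BoundedAt-sym : ∀ {r} {v : Vec ℕ r} {A B} → BoundedAt v A B → BoundedAt v B A
  BoundedAt-sym {r} {v} {A} {B} =
    subst₂ (λ d n → M r v * d ≤ n * multinomial (reduced v)) (den-comm A B) (num-comm A B)

  Bound : ∀ {r} → Vec ℕ r → Set
  Bound {r} v = 2 ≤ r → (∀ i → 2 ≤ lookup v i) → ∀ {t s} → TopTwo v t s → Bounded v t s

  BoundBelow : ℕ → Set
  BoundBelow n = ∀ {r} (w : Vec ℕ r) → sum w < n → Bound w

  bounded-pair : ∀ {a b} → 2 ≤ a → 2 ≤ b → BoundedAt (a ∷ b ∷ []) a b
  bounded-pair {suc (suc p)} {suc (suc q)} (s≤s (s≤s _)) (s≤s (s≤s _)) = ≤-reflexive (begin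
    M 2 (2 + p ∷ 2 + q ∷ []) * den (2 + p) (2 + q)
      ≡⟨ cong (_* den (2 + p) (2 + q)) (base (2 + p) (2 + q) (s≤s (s≤s z≤n)) (s≤s (s≤s z≤n))) ⟩
    (((2 + p) + (2 + q) ∸ 2) C (1 + p)) * ((1 + p) * (1 + q))
      ≡⟨ cong (λ n → ((n ∸ 2) C (1 + p)) * ((1 + p) * (1 + q))) ([1+a]+[2+b]≡3+[a+b] (1 + p) q) ⟩
    ((2 + (p + q)) C (1 + p)) * ((1 + p) * (1 + q))
      ≡⟨ binomial-base p q ⟩
    (2 + (p + q)) * (1 + (p + q)) * multinomial (p ∷ q ∷ [])
      ≡⟨ cong (_* multinomial (p ∷ q ∷ [])) (num-1+2+ (1 + p) q) ⟨
    num (2 + p) (2 + q) * multinomial (p ∷ q ∷ []) ∎)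
    where open ≡-Reasoning

  bounded-insertAt-2 : ∀ {R} (w : Vec ℕ R) i {t s} → 2 ≤ R → (∀ j → 2 ≤ lookup w j) →
                       Bounded w t s → Bounded (insertAt w i 2) (punchIn i t) (punchIn i s)
  bounded-insertAt-2 w i {t} {s} R≥2 w≥2 bound
    rewrite insert2 _ R≥2 w (lookup⁻ w≥2) i | insertAt-punchIn w i 2 t | insertAt-punchIn w i 2 s
          | map-insertAt (_∸ 2) 2 w i | multinomial-insertAt-0 (reduced w) i = bound

  bounded-removing-2 : ∀ {R} (v : Vec ℕ (suc R)) → BoundBelow (sum v) → 2 ≤ R → (∀ j → 2 ≤ lookup v j) →
                       ∀ {t s i} → TopTwo v t s → (i≢t : i ≢ t) (i≢s : i ≢ s) → lookup v i ≡ 2 → Bounded v t s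
  bounded-removing-2 v ih R≥2 v≥2 {t} {s} {i} top i≢t i≢s vᵢ≡2 =
    subst (λ u → Bounded u t s) v≡
      (subst₂ (Bounded (insertAt w i 2)) (punchIn-punchOut i≢t) (punchIn-punchOut i≢s)
        (bounded-insertAt-2 w i R≥2 w≥2 (ih w w<v R≥2 w≥2 top-w)))
    where
    w = removeAt v i
    v≡ : insertAt w i 2 ≡ v
    v≡ = subst (λ x → insertAt w i x ≡ v) vᵢ≡2 (insertAt-removeAt v i)
    w≡v∘punchIn : ∀ j → lookup w j ≡ lookup v (punchIn i j)
    w≡v∘punchIn j = trans (sym (insertAt-punchIn w i 2 j)) (cong (λ u → lookup u (punchIn i j)) v≡)
    w≥2 : ∀ j → 2 ≤ lookup w j
    w≥2 j = subst (2 ≤_) (sym (w≡v∘punchIn j)) (v≥2 (punchIn i j))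
    w<v : sum w < sum v
    w<v = subst (sum w <_) (trans (sym (sum-insertAt w i 2)) (cong sum v≡)) (m<n+m (sum w) (s≤s z≤n))
    top-w : TopTwo w (punchOut i≢t) (punchOut i≢s)
    top-w = TopTwo-pullback (punchIn-injective i _ _) w≡v∘punchIn
              (subst₂ (TopTwo v) (sym (punchIn-punchOut i≢t)) (sym (punchIn-punchOut i≢s)) top)

  module Lowering {r} (v : Vec ℕ r) (ih : BoundBelow (sum v)) (r≥2 : 2 ≤ r) (v≥3 : ∀ i → 3 ≤ lookup v i) where

    N : ℕ
    N = sum (reduced v)

    μ : ℕ
    μ = multinomial (reduced v)

    lower : Fin r → Vec ℕ r
    lower i = updateAt v i pred

    lower≥2 : ∀ i j → 2 ≤ lookup (lower i) j
    lower≥2 i j with j ≟ᶠ i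
    ... | yes refl = subst (2 ≤_) (sym (lookup∘updateAt j v)) (suc[m]≤n⇒m≤pred[n] (v≥3 j))
    ... | no j≢i   = subst (2 ≤_) (sym (lookup∘updateAt′ j i j≢i v)) (≤-trans (n≤1+n 2) (v≥3 j))

    bounded-lower : ∀ i {t s} → TopTwo (lower i) t s → Bounded (lower i) t s
    bounded-lower i =
      ih (lower i) (≤-reflexive (sum-updateAt-pred v i (≤-trans (s≤s z≤n) (v≥3 i)))) r≥2 (lower≥2 i)

    lower-other : ∀ {i t s} → i ≢ t → i ≢ s → TopTwo v t s → let A = lookup v t; B = lookup v s in
      M r (lower i) * (den A B * N) ≤ (lookup v i ∸ 2) * (num A B * μ)
    lower-other {i} {t} {s} i≢t i≢s top = begin
      M r (lower i) * (den A B * N)                  ≡⟨ *-assoc (M r (lower i)) (den A B) N ⟨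
      M r (lower i) * den A B * N                    ≤⟨ *-monoˡ-≤ N bound ⟩
      num A B * multinomial (reduced (lower i)) * N  ≡⟨ *-assoc (num A B) _ N ⟩
      num A B * (multinomial (reduced (lower i)) * N)
        ≡⟨ cong (num A B *_) (multinomial-reduced-updateAt-pred v i (v≥3 i)) ⟩
      num A B * ((lookup v i ∸ 2) * μ)               ≡⟨ x*[y*z]≡y*[x*z] (num A B) (lookup v i ∸ 2) μ ⟩
      (lookup v i ∸ 2) * (num A B * μ)               ∎
      where
      open ≤-Reasoning
      A = lookup v t
      B = lookup v s
      bound : BoundedAt (lower i) A B
      bound = subst₂ (BoundedAt (lower i)) (lookup∘updateAt′ t i (i≢t ∘ sym) v)
                (lookup∘updateAt′ s i (i≢s ∘ sym) v) (bounded-lower i (TopTwo-lower-other v i≢t i≢s top))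

    lower-first : ∀ {t s} → TopTwo v t s → let A = lookup v t; B = lookup v s in
      M r (lower t) * (den A B * N) ≤ share A B * μ
    lower-first {t} {s} top with any? (λ j → ¬? (j ≟ᶠ t) ×-dec ¬? (j ≟ᶠ s) ×-dec (lookup v t ≤? lookup v j))
    ... | yes (j , j≢t , j≢s , vₜ≤vⱼ) =
      share-bound-tied {m = M r (lower t)} (≤-trans (n≤1+n 2) (v≥3 t))
        (subst (_≤ lookup v s) vⱼ≡vₜ (≤-second top j j≢t j≢s))
        (subst₂ (BoundedAt (lower t)) (trans (lookup∘updateAt′ j t j≢t v) vⱼ≡vₜ) (lookup∘updateAt′ s t s≢t v)
          (bounded-lower t (TopTwo-lower-first-tied v j≢t j≢s vⱼ≡vₜ top)))
        (multinomial-reduced-updateAt-pred v t (v≥3 t))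
      where
      s≢t = distinct top ∘ sym
      vⱼ≡vₜ : lookup v j ≡ lookup v t
      vⱼ≡vₜ = ≤-antisym (≤-first top j j≢t j≢s) vₜ≤vⱼ
    ... | no no-tie =
      share-bound-lowered {m = M r (lower t)} (v≥3 t)
        (subst₂ (BoundedAt (lower t)) (lookup∘updateAt t v) (lookup∘updateAt′ s t (distinct top ∘ sym) v)
          (bounded-lower t (TopTwo-lower-first v others<t top)))
        (multinomial-reduced-updateAt-pred v t (v≥3 t))
      where
      others<t : ∀ j → j ≢ t → j ≢ s → lookup v j < lookup v t
      others<t j j≢t j≢s = ≰⇒> (λ vₜ≤vⱼ → no-tie (j , j≢t , j≢s , vₜ≤vⱼ))

    lower-top-two : ∀ {t s} → TopTwo v t s → let A = lookup v t; B = lookup v s in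
      M r (lower t) * (den A B * N) + M r (lower s) * (den A B * N) ≤ (A ∸ 2) * (num A B * μ) + (B ∸ 2) * (num A B * μ)
    lower-top-two {t} {s} top = begin
      M r (lower t) * (den A B * N) + M r (lower s) * (den A B * N)
        ≤⟨ +-mono-≤ (lower-first top) (subst (λ d → M r (lower s) * (d * N) ≤ share B A * μ) (den-comm B A)
                                              (lower-first (TopTwo-sym top))) ⟩
      share A B * μ + share B A * μ                   ≡⟨ *-distribʳ-+ μ (share A B) (share B A) ⟨
      (share A B + share B A) * μ
        ≡⟨ cong (_* μ) (share+share≡num*[A∸2+B∸2] (v≥3 t) (v≥3 s)) ⟩
      num A B * ((A ∸ 2) + (B ∸ 2)) * μ               ≡⟨ distribute (num A B) (A ∸ 2) (B ∸ 2) μ ⟩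
      (A ∸ 2) * (num A B * μ) + (B ∸ 2) * (num A B * μ) ∎
      where
      open ≤-Reasoning
      A = lookup v t
      B = lookup v s
      distribute : ∀ q x y μ → q * (x + y) * μ ≡ x * (q * μ) + y * (q * μ)
      distribute = solve-∀

    N≥1 : Fin r → 1 ≤ N
    N≥1 t = ≤-trans (subst (1 ≤_) (sym (lookup-map t (_∸ 2) v)) (∸-monoˡ-≤ 2 (v≥3 t)))
                    (lookup≤sum (reduced v) t)

  bounded-interior : ∀ {R} (v : Vec ℕ (3 + R)) → BoundBelow (sum v) → (∀ i → 3 ≤ lookup v i) →
                     ∀ {t s} → TopTwo v t s → Bounded v t s
  bounded-interior {R} v ih v≥3 {t} {s} top = *-cancelʳ-≤ _ _ N {{>-nonZero (N≥1 t)}} (begin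
    M r v * den A B * N
      ≡⟨ *-assoc (M r v) (den A B) N ⟩
    M r v * (den A B * N)
      ≡⟨ cong (_* (den A B * N)) (recur r (s≤s (s≤s z≤n)) v (lookup⁻ v≥3)) ⟩
    sum (tabulate (M r ∘ lower)) * (den A B * N)
      ≡⟨ sum-tabulate-*ʳ (M r ∘ lower) (den A B * N) ⟨
    sum (tabulate (λ i → M r (lower i) * (den A B * N)))
      ≤⟨ sum-tabulate-mono-≤-except₂ (distinct top) (λ i i≢t i≢s → lower-other i≢t i≢s top) (lower-top-two top) ⟩
    sum (tabulate (λ i → (lookup v i ∸ 2) * (num A B * μ)))
      ≡⟨ sum-tabulate-*ʳ (λ i → lookup v i ∸ 2) (num A B * μ) ⟩
    sum (tabulate (λ i → lookup v i ∸ 2)) * (num A B * μ)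
      ≡⟨ cong (_* (num A B * μ)) (sum-map-lookup (_∸ 2) v) ⟨
    N * (num A B * μ)
      ≡⟨ *-comm N (num A B * μ) ⟩
    num A B * μ * N ∎)
    where
    open Lowering v ih (s≤s (s≤s z≤n)) v≥3
    open ≤-Reasoning
    r = 3 + R
    A = lookup v t
    B = lookup v s

  bounded-step : ∀ {r} (v : Vec ℕ r) → BoundBelow (sum v) → Bound v
  bounded-step []           _ ()
  bounded-step (_ ∷ [])     _ (s≤s ())
  bounded-step (a ∷ b ∷ []) _ _ v≥2 {zero}     {suc zero} _   = bounded-pair (v≥2 zero) (v≥2 (suc zero))
  bounded-step (a ∷ b ∷ []) _ _ v≥2 {suc zero} {zero}     _   =
    BoundedAt-sym {v = a ∷ b ∷ []} {a} {b} (bounded-pair (v≥2 zero) (v≥2 (suc zero)))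
  bounded-step (_ ∷ _ ∷ []) _ _ _   {zero}     {zero}     top = contradiction refl (distinct top)
  bounded-step (_ ∷ _ ∷ []) _ _ _   {suc zero} {suc zero} top = contradiction refl (distinct top)
  bounded-step v@(_ ∷ _ ∷ _ ∷ _) ih _ v≥2 {t} {s} top
    with any? (λ j → ¬? (j ≟ᶠ t) ×-dec ¬? (j ≟ᶠ s) ×-dec (lookup v j ≟ 2))
  ... | yes (j , j≢t , j≢s , vⱼ≡2) = bounded-removing-2 v ih (s≤s (s≤s z≤n)) v≥2 top j≢t j≢s vⱼ≡2
  ... | no no-other-2 = bounded-interior v ih (TopTwo-all≥ top others≥3) top
    where
    others≥3 : ∀ j → j ≢ t → j ≢ s → 3 ≤ lookup v j
    others≥3 j j≢t j≢s = ≤∧≢⇒< (v≥2 j) (λ 2≡vⱼ → no-other-2 (j , j≢t , j≢s , sym 2≡vⱼ))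

  bound-below : ∀ n → BoundBelow n
  bound-below (suc n) w (s≤s w≤n) = bounded-step w (λ u u<w → bound-below n u (≤-trans u<w w≤n))

  bounded : ∀ {r} (v : Vec ℕ r) → Bound v
  bounded v = bound-below (suc (sum v)) v ≤-refl

  sorted-bound : ∀ n k₁ k₂ (ks : Vec ℕ n) →
    (∀ (i j : Fin (2 + n)) → i Data.Fin.≤ j → lookup (k₁ ∷ k₂ ∷ ks) j ≤ lookup (k₁ ∷ k₂ ∷ ks) i) →
    All (2 ≤_) (k₁ ∷ k₂ ∷ ks) → BoundedAt (k₁ ∷ k₂ ∷ ks) k₁ k₂
  sorted-bound n k₁ k₂ ks sorted k≥2 =
    bounded (k₁ ∷ k₂ ∷ ks) (s≤s (s≤s z≤n)) (lookup⁺ k≥2) (sorted⇒TopTwo _ sorted)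

  diagonal-bound : ∀ r k → 2 ≤ r → 2 ≤ k →
    M r (replicate r k) * (k ∸ 1)
      ≤ (4 * (k ∸ 1) ∸ 2) * _/_ ((r * (k ∸ 2)) !) (((k ∸ 2) !) ^ r) {{m^n≢0 ((k ∸ 2) !) r {{(k ∸ 2) !≢0}}}}
  diagonal-bound (suc (suc n)) (suc (suc a)) (s≤s (s≤s _)) (s≤s (s≤s _)) = *-cancelˡ-≤ (1 + a) (begin
    (1 + a) * (M r v * (1 + a))                     ≡⟨ x*[y*z]≡y*[x*z] (1 + a) (M r v) (1 + a) ⟩
    M r v * den k k                                 ≤⟨ sorted-bound n k k (replicate n k) sorted (lookup⁻ k≥2) ⟩
    num k k * multinomial (reduced v)               ≡⟨ cong₂ _*_ (num-diagonal a) reduced-multinomial ⟩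
    (1 + a) * (4 * (1 + a) ∸ 2) * X                 ≡⟨ *-assoc (1 + a) (4 * (1 + a) ∸ 2) X ⟩
    (1 + a) * ((4 * (1 + a) ∸ 2) * X)               ∎)
    where
    open ≤-Reasoning
    r = 2 + n
    k = 2 + a
    v = replicate r k
    X = _/_ ((r * a) !) ((a !) ^ r) {{m^n≢0 (a !) r {{a !≢0}}}}
    sorted : ∀ i j → i Data.Fin.≤ j → lookup v j ≤ lookup v i
    sorted i j _ = ≤-reflexive (trans (lookup-replicate j k) (sym (lookup-replicate i k)))
    k≥2 : ∀ i → 2 ≤ lookup v i
    k≥2 i = subst (2 ≤_) (sym (lookup-replicate i k)) (s≤s (s≤s z≤n))
    reduced-multinomial : multinomial (reduced v) ≡ X
    reduced-multinomial = trans (cong multinomial (map-replicate (_∸ 2) k r)) (multinomial-replicate r a)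

theorem3p3 : (M : (r : ℕ) → Vec ℕ r → ℕ) → IsMFamily M →
    ((n : ℕ) (k₁ k₂ : ℕ) (ks : Vec ℕ n) →
      (∀ (i j : Fin (2 + n)) → i Data.Fin.≤ j →
        lookup (k₁ ∷ k₂ ∷ ks) j ≤ lookup (k₁ ∷ k₂ ∷ ks) i) →
      All (2 ≤_) (k₁ ∷ k₂ ∷ ks) →
      M (2 + n) (k₁ ∷ k₂ ∷ ks) * ((k₁ ∸ 1) * (k₂ ∸ 1))
        ≤ ((k₁ + k₂ ∸ 2) * (k₁ + k₂ ∸ 3))
          * multinomial (map (λ k → k ∸ 2) (k₁ ∷ k₂ ∷ ks)))
    ×
    ((r k : ℕ) → 2 ≤ r → 2 ≤ k →
      M r (replicate r k) * (k ∸ 1)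
        ≤ (4 * (k ∸ 1) ∸ 2)
          * _/_ ((r * (k ∸ 2)) !) (((k ∸ 2) !) ^ r) {{m^n≢0 ((k ∸ 2) !) r {{(k ∸ 2) !≢0}}}})
theorem3p3 M isM = sorted-bound , diagonal-bound
  where open Bounds M isM
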